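{- If $x\in\mathcal{P}_\infty$, then $x$ is uniformly recurrent.
   Context: All alphabets are finite. A prefixal factorization of an infinite word $x$ is a factorization $x=V_0V_1\cdots$ with every $V_i$ a non-empty prefix of $x$. A finite non-empty word is unbordered if no non-empty word other than itself is both a prefix and a suffix of it; $UP(x)$ is the set of non-empty unbordered prefixes of $x$. $\mathcal{P}_1$ is the set of infinite words admitting a prefixal factorization; each $x\in\mathcal{P}_1$ has a unique factorization $x=U_0U_1\cdots$ with $U_i\in UP(x)$. With $UP'(x)=\{U_i:i\ge0\}$, $n_x=\mathrm{card}(UP'(x))$, $UP'(x)$ ordered by index of first occurrence in this factorization, and $\phi:\{1,\dots,n_x\}\to UP'(x)$ the order-preserving bijection, the derived word is $\delta(x)=\phi^{ -1}(U_0)\phi^{ -1}(U_1)\cdots$. Define $\mathcal{P}_{n+1}=\{x\in\mathcal{P}_n:\delta(x)\in\mathcal{P}_n\}$, $\mathcal{P}_\infty=\bigcap_{n\ge1}\mathcal{P}_n$. An infinite word is uniformly recurrent if for each of its factors $u$ there is $k$ such that every factor of length $k$ contains an occurrence of $u$. -}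

module Defs where

open import Data.Nat using (ℕ; zero; suc; _+_; _∸_; _<_; _≤_; _≟_)
open import Data.List using (List; []; _∷_; _++_; [_])
open import Data.Product using (Σ; ∃; _×_)
open import Data.Unit using (⊤)
open import Relation.Nullary using (¬_; yes; no)
open import Relation.Binary.PropositionalEquality using (_≡_)
open import Data.List.Membership.DecPropositional _≟_ using (_∈?_)

-- Infinite words: letters are natural numbers; finiteness of the alphabet
-- is an explicit condition.
Word : Set
Word = ℕ → ℕ

FiniteAlphabet : Word → Set
FiniteAlphabet x = ∃ λ k → ∀ i → x i < k

-- A factorization x = V_0 V_1 ... is given by the lengths ℓ i of the V_i;
-- pos ℓ i is the starting position of V_i.
pos : (ℕ → ℕ) → ℕ → ℕ
pos ℓ zero = zero
pos ℓ (suc i) = pos ℓ i + ℓ i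

-- every V_i is a non-empty prefix of x (the V_i have positive length, so
-- the factors cover all of x)
IsPrefixalFactorization : Word → (ℕ → ℕ) → Set
IsPrefixalFactorization x ℓ =
  ∀ i → (0 < ℓ i) × (∀ j → j < ℓ i → x (pos ℓ i + j) ≡ x j)

UnborderedPrefix : Word → ℕ → Set
UnborderedPrefix x n =
  (0 < n) × (∀ b → 0 < b → b < n → ¬ (∀ j → j < b → x j ≡ x ((n ∸ b) + j)))

IsUPFactorization : Word → (ℕ → ℕ) → Set
IsUPFactorization x ℓ = IsPrefixalFactorization x ℓ × (∀ i → UnborderedPrefix x (ℓ i))

seen : (ℕ → ℕ) → ℕ → List ℕ
seen ℓ zero = []
seen ℓ (suc n) with ℓ n ∈? seen ℓ n
... | yes _ = seen ℓ n
... | no _ = seen ℓ n ++ [ ℓ n ]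

indexOf : ℕ → List ℕ → ℕ
indexOf v [] = zero
indexOf v (w ∷ ws) with v ≟ w
... | yes _ = zero
... | no _ = suc (indexOf v ws)

-- derived word: δ(x)_i = φ⁻¹(U_i) ∈ {1,...,n_x}, where φ enumerates the
-- distinct U_i (equivalently their lengths) by order of first occurrence
derived : (ℕ → ℕ) → Word
derived ℓ i = suc (indexOf (ℓ i) (seen ℓ (suc i)))

-- P n x  stands for  x ∈ 𝒫_n  (n ≥ 1); P 0 is unused.
P : ℕ → Word → Set
P zero x = ⊤
P (suc zero) x = FiniteAlphabet x × ∃ λ ℓ → IsPrefixalFactorization x ℓ
P (suc (suc n)) x =
  P (suc n) x ×
  ∃ λ ℓ → IsUPFactorization x ℓ × FiniteAlphabet (derived ℓ) × P (suc n) (derived ℓ)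

PInfinity : Word → Set
PInfinity x = ∀ n → P (suc n) x

UniformlyRecurrent : Word → Set
UniformlyRecurrent x =
  ∀ p L → ∃ λ K → ∀ q → ∃ λ r →
    (q ≤ r) × (r + L ≤ q + K) × (∀ j → j < L → x (r + j) ≡ x (p + j))

-- Let y = U₀U₁⋯ be the factorization into unbordered prefixes. No unbordered prefix
-- is longer than U₀, since a later block starting inside it would give a border; so
-- block lengths are bounded by |U₀|. An occurrence of the prefix of length k of δ(y)
-- at index r is a run of blocks Uᵣ⋯Uᵣ₊ₖ₋₁ equal to U₀⋯Uₖ₋₁, hence an occurrence of
-- the prefix of y they cover, and bounded gaps in δ(y) become bounded gaps in y.
-- When |U₀| ≥ 2, m + 1 blocks cover at least m + 2 letters (otherwise y is constant),
-- so induction on m shows that the prefix of length m of every y ∈ 𝒫ₘ₊₂ occurs with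
-- bounded gaps. Every factor lies inside a prefix.

module Submission where

open import Defs
open import Data.Nat
open import Data.Nat.Properties
open import Data.List using ([]; _∷_; _++_; [_])
open import Data.List.Properties using (++-identityʳ; ++-assoc)
open import Data.List.Membership.Propositional using (_∈_)
open import Data.List.Membership.Propositional.Properties using (∈-++⁺ˡ; ∈-++⁺ʳ)
open import Data.List.Relation.Unary.Any using (here; tail)
open import Data.List.Membership.DecPropositional _≟_ using (_∈?_)
open import Data.Product
open import Data.Empty using (⊥-elim)
open import Relation.Nullary using (yes; no)
open import Relation.Binary.PropositionalEquality hiding ([_])

seen-suc : ∀ (ℓ : ℕ → ℕ) n → ∃ λ t → seen ℓ (suc n) ≡ seen ℓ n ++ t
seen-suc ℓ n with ℓ n ∈? seen ℓ n
... | yes _ = [] , sym (++-identityʳ _)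
... | no _ = [ ℓ n ] , refl

seen-mono : ∀ (ℓ : ℕ → ℕ) {m n} → m ≤′ n → ∃ λ t → seen ℓ n ≡ seen ℓ m ++ t
seen-mono ℓ ≤′-refl = [] , sym (++-identityʳ _)
seen-mono ℓ {m} (≤′-step {n} m≤′n) with seen-mono ℓ m≤′n | seen-suc ℓ n
... | t , eq | u , eq′ =
  t ++ u , trans eq′ (trans (cong (_++ u) eq) (++-assoc (seen ℓ m) t u))

∈-seen : ∀ (ℓ : ℕ → ℕ) n → ℓ n ∈ seen ℓ (suc n)
∈-seen ℓ n with ℓ n ∈? seen ℓ n
... | yes ℓn∈ = ℓn∈
... | no _ = ∈-++⁺ʳ (seen ℓ n) (here refl)

indexOf-++ : ∀ {v} s t → v ∈ s → indexOf v (s ++ t) ≡ indexOf v s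
indexOf-++ {v} (w ∷ ws) t v∈ with v ≟ w
... | yes _ = refl
... | no v≢w = cong suc (indexOf-++ ws t (tail v≢w v∈))

indexOf-injective : ∀ {a b} s → a ∈ s → b ∈ s → indexOf a s ≡ indexOf b s → a ≡ b
indexOf-injective {a} {b} (w ∷ ws) a∈ b∈ eq with a ≟ w | b ≟ w
... | yes a≡w | yes b≡w = trans a≡w (sym b≡w)
... | yes _ | no _ = ⊥-elim (0≢1+n eq)
... | no _ | yes _ = ⊥-elim (0≢1+n (sym eq))
... | no a≢w | no b≢w = indexOf-injective ws (tail a≢w a∈) (tail b≢w b∈) (suc-injective eq)

indexOf-seen-stable : ∀ (ℓ : ℕ → ℕ) {i N} → suc i ≤ N →
  ℓ i ∈ seen ℓ N × indexOf (ℓ i) (seen ℓ N) ≡ indexOf (ℓ i) (seen ℓ (suc i))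
indexOf-seen-stable ℓ {i} i<N with seen-mono ℓ (≤⇒≤′ i<N)
... | t , eq rewrite eq = ∈-++⁺ˡ (∈-seen ℓ i) , indexOf-++ (seen ℓ (suc i)) t (∈-seen ℓ i)

derived-injective : ∀ (ℓ : ℕ → ℕ) i j → derived ℓ i ≡ derived ℓ j → ℓ i ≡ ℓ j
derived-injective ℓ i j eq with indexOf-seen-stable ℓ (m≤m+n (suc i) (suc j))
                              | indexOf-seen-stable ℓ (m≤n+m (suc j) (suc i))
... | ℓi∈ , stable-i | ℓj∈ , stable-j =
  indexOf-injective _ ℓi∈ ℓj∈ (trans stable-i (trans (suc-injective eq) (sym stable-j)))

PrefixOccursAt : Word → ℕ → ℕ → Set
PrefixOccursAt y m r = ∀ j → j < m → y (r + j) ≡ y j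

PrefixOccursWithin : Word → ℕ → ℕ → ℕ → Set
PrefixOccursWithin y m q K = ∃ λ r → q ≤ r × r + m ≤ q + K × PrefixOccursAt y m r

SyndeticPrefix : Word → ℕ → Set
SyndeticPrefix y m = ∃ λ K → ∀ q → PrefixOccursWithin y m q K

syndetic-empty : ∀ y → SyndeticPrefix y 0
syndetic-empty y = 0 , λ q → q , ≤-refl , ≤-refl , λ _ ()

syndetic-shorten : ∀ {y m n} → m ≤ n → SyndeticPrefix y n → SyndeticPrefix y m
syndetic-shorten m≤n (K , recur) = K , λ q → shorten (recur q)
  where
    shorten : ∀ {q} → PrefixOccursWithin _ _ q K → PrefixOccursWithin _ _ q K
    shorten (r , q≤r , r+n≤ , occ) =
      r , q≤r , ≤-trans (+-monoʳ-≤ r m≤n) r+n≤ , λ j j<m → occ j (<-≤-trans j<m m≤n)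

syndetic-constant : ∀ {y} → (∀ i → y i ≡ y 0) → ∀ m → SyndeticPrefix y m
syndetic-constant const m =
  m , λ q → q , ≤-refl , ≤-refl , λ j _ → trans (const (q + j)) (sym (const j))

module Factorization {y : Word} {ℓ : ℕ → ℕ} (pf : IsPrefixalFactorization y ℓ) where

  ℓ-positive : ∀ i → 0 < ℓ i
  ℓ-positive i = proj₁ (pf i)

  block-prefix : ∀ i j → j < ℓ i → y (pos ℓ i + j) ≡ y j
  block-prefix i = proj₂ (pf i)

  pos-mono : ∀ {a b} → a ≤ b → pos ℓ a ≤ pos ℓ b
  pos-mono a≤b = go (≤⇒≤′ a≤b)
    where
      go : ∀ {a b} → a ≤′ b → pos ℓ a ≤ pos ℓ b
      go ≤′-refl = ≤-refl
      go (≤′-step a≤′b) = ≤-trans (go a≤′b) (m≤m+n _ _)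

  blockOf : ℕ → ℕ
  blockOf zero = zero
  blockOf (suc q) with suc q <? pos ℓ (suc (blockOf q))
  ... | yes _ = blockOf q
  ... | no _ = suc (blockOf q)

  blockOf-spec : ∀ q → pos ℓ (blockOf q) ≤ q × q < pos ℓ (suc (blockOf q))
  blockOf-spec zero = z≤n , ℓ-positive 0
  blockOf-spec (suc q) with suc q <? pos ℓ (suc (blockOf q))
  ... | yes q+1<next = m≤n⇒m≤1+n (proj₁ (blockOf-spec q)) , q+1<next
  ... | no q+1≮next = ≮⇒≥ q+1≮next , ≤-<-trans (proj₂ (blockOf-spec q)) (m<m+n _ (ℓ-positive _))

  block-offset : ∀ q → let b = blockOf q in pos ℓ b + (q ∸ pos ℓ b) ≡ q × q ∸ pos ℓ b < ℓ b
  block-offset q =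
    m+[n∸m]≡n start≤q ,
    +-cancelˡ-< (pos ℓ b) _ _ (subst (_< pos ℓ (suc b)) (sym (m+[n∸m]≡n start≤q)) q<next)
    where
      b = blockOf q
      start≤q = proj₁ (blockOf-spec q)
      q<next = proj₂ (blockOf-spec q)

  pos-+ : ∀ r k → (∀ i → i < k → ℓ (r + i) ≡ ℓ i) → pos ℓ (r + k) ≡ pos ℓ r + pos ℓ k
  pos-+ r zero _ = trans (cong (pos ℓ) (+-identityʳ r)) (sym (+-identityʳ _))
  pos-+ r (suc k) same rewrite +-suc r k = begin
    pos ℓ (r + k) + ℓ (r + k)  ≡⟨ cong₂ _+_ (pos-+ r k (λ i i<k → same i (m≤n⇒m≤1+n i<k))) (same k ≤-refl) ⟩
    pos ℓ r + pos ℓ k + ℓ k    ≡⟨ +-assoc (pos ℓ r) (pos ℓ k) (ℓ k) ⟩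
    pos ℓ r + pos ℓ (suc k)    ∎
    where open ≡-Reasoning

  pos-+-≤ : ∀ {M} → (∀ i → ℓ i ≤ M) → ∀ a k → pos ℓ (a + k) ≤ pos ℓ a + k * M
  pos-+-≤ ℓ≤M a zero rewrite +-identityʳ a = m≤m+n _ _
  pos-+-≤ {M} ℓ≤M a (suc k) rewrite +-suc a k = begin
    pos ℓ (a + k) + ℓ (a + k) ≤⟨ +-mono-≤ (pos-+-≤ ℓ≤M a k) (ℓ≤M (a + k)) ⟩
    pos ℓ a + k * M + M       ≡⟨ +-assoc (pos ℓ a) (k * M) M ⟩
    pos ℓ a + (k * M + M)     ≡⟨ cong (pos ℓ a +_) (+-comm (k * M) M) ⟩
    pos ℓ a + suc k * M       ∎
    where open ≤-Reasoning

  prefix-at-block : ∀ r k → (∀ i → i < k → ℓ (r + i) ≡ ℓ i) →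
    ∀ j → j < pos ℓ k → y (pos ℓ r + j) ≡ y j
  prefix-at-block r k same j j<end with blockOf j <? k | block-offset j
  ... | no b≮k | _ =
    ⊥-elim (<-irrefl refl (<-≤-trans j<end (≤-trans (pos-mono (≮⇒≥ b≮k)) (proj₁ (blockOf-spec j)))))
  ... | yes b<k | j≡start+t , t<ℓb = begin
    y (pos ℓ r + j)                 ≡⟨ cong (λ p → y (pos ℓ r + p)) (sym j≡start+t) ⟩
    y (pos ℓ r + (pos ℓ b + t))     ≡⟨ cong y (sym (+-assoc (pos ℓ r) (pos ℓ b) t)) ⟩
    y (pos ℓ r + pos ℓ b + t)       ≡⟨ cong (λ p → y (p + t)) (sym (pos-+ r b same-before-b)) ⟩
    y (pos ℓ (r + b) + t)           ≡⟨ block-prefix (r + b) t (subst (t <_) (sym (same b b<k)) t<ℓb) ⟩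
    y t                             ≡⟨ sym (block-prefix b t t<ℓb) ⟩
    y (pos ℓ b + t)                 ≡⟨ cong y j≡start+t ⟩
    y j                             ∎
    where
      open ≡-Reasoning
      b = blockOf j
      t = j ∸ pos ℓ b
      same-before-b : ∀ i → i < b → ℓ (r + i) ≡ ℓ i
      same-before-b i i<b = same i (<-trans i<b b<k)

  unbordered-≤-head : ∀ {n} → UnborderedPrefix y n → n ≤ ℓ 0
  unbordered-≤-head {suc p} (_ , unbordered) with blockOf p | blockOf-spec p
  ... | zero | _ , p<ℓ₀ = p<ℓ₀
  ... | suc c | s≤p , p<next =
    ⊥-elim (unbordered (suc p ∸ s) (m<n⇒0<n∸m (s≤s s≤p)) (∸-monoʳ-< 0<s (m≤n⇒m≤1+n s≤p)) border)
    where
      s = pos ℓ (suc c)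
      0<s : 0 < s
      0<s = ≤-trans (ℓ-positive c) (m≤n+m (ℓ c) (pos ℓ c))
      border : ∀ j → j < suc p ∸ s → y j ≡ y ((suc p ∸ (suc p ∸ s)) + j)
      border j j<β rewrite m∸[m∸n]≡n (m≤n⇒m≤1+n s≤p) = sym (block-prefix (suc c) j j<ℓ)
        where
          j<ℓ : j < ℓ (suc c)
          j<ℓ = +-cancelˡ-< s j _ (≤-<-trans s+j≤p p<next)
            where
              s+j≤p : s + j ≤ p
              s+j≤p = subst (_≤ p) (+-comm j s) (s≤s⁻¹ (m≤o∸n⇒m+n≤o (suc j) (m≤n⇒m≤1+n s≤p) j<β))

  pos[1+k]≥2+k : 2 ≤ ℓ 0 → ∀ k → suc (suc k) ≤ pos ℓ (suc k)
  pos[1+k]≥2+k 2≤ℓ₀ zero = 2≤ℓ₀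
  pos[1+k]≥2+k 2≤ℓ₀ (suc k) =
    subst (_≤ pos ℓ (suc (suc k))) (+-comm (suc (suc k)) 1)
      (+-mono-≤ (pos[1+k]≥2+k 2≤ℓ₀ k) (ℓ-positive (suc k)))

  unit-blocks-constant : (∀ i → ℓ i ≡ 1) → ∀ i → y i ≡ y 0
  unit-blocks-constant unit i =
    trans (cong y (sym (trans (+-identityʳ _) (pos-unit i)))) (block-prefix i 0 (ℓ-positive i))
    where
      pos-unit : ∀ i → pos ℓ i ≡ i
      pos-unit zero = refl
      pos-unit (suc i) = trans (cong₂ _+_ (pos-unit i) (unit i)) (+-comm i 1)

  module BoundedBlocks {M : ℕ} (ℓ≤M : ∀ i → ℓ i ≤ M) where

    next-block-within : ∀ q → q ≤ pos ℓ (suc (blockOf q)) × pos ℓ (suc (blockOf q)) ≤ q + M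
    next-block-within q =
      <⇒≤ (proj₂ (blockOf-spec q)) , +-mono-≤ (proj₁ (blockOf-spec q)) (ℓ≤M (blockOf q))

    syndetic-letter : SyndeticPrefix y 1
    syndetic-letter = M + 1 , λ q → let (q≤s , s≤q+M) = next-block-within q in
      pos ℓ (suc (blockOf q)) , q≤s , ≤-trans (+-monoˡ-≤ 1 s≤q+M) (≤-reflexive (+-assoc q M 1)) ,
      λ { zero _ → block-prefix (suc (blockOf q)) 0 (ℓ-positive _) ; (suc _) (s≤s ()) }

    syndetic-lift : ∀ {k} → SyndeticPrefix (derived ℓ) k → SyndeticPrefix y (pos ℓ k)
    syndetic-lift {k} (K′ , recur) = M + K′ * M , λ q → lift q (recur (suc (blockOf q)))
      where
        lift : ∀ q → PrefixOccursWithin (derived ℓ) k (suc (blockOf q)) K′ →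
               PrefixOccursWithin y (pos ℓ k) q (M + K′ * M)
        lift q (r′ , b≤r′ , r′+k≤b+K′ , occ) =
          pos ℓ r′ , ≤-trans q≤s (pos-mono b≤r′) , within , prefix-at-block r′ k same
          where
            open ≤-Reasoning
            b = suc (blockOf q)
            q≤s = proj₁ (next-block-within q)
            s≤q+M = proj₂ (next-block-within q)
            same : ∀ i → i < k → ℓ (r′ + i) ≡ ℓ i
            same i i<k = derived-injective ℓ (r′ + i) i (occ i i<k)
            within : pos ℓ r′ + pos ℓ k ≤ q + (M + K′ * M)
            within = begin
              pos ℓ r′ + pos ℓ k   ≡⟨ sym (pos-+ r′ k same) ⟩
              pos ℓ (r′ + k)       ≤⟨ pos-mono r′+k≤b+K′ ⟩
              pos ℓ (b + K′)       ≤⟨ pos-+-≤ ℓ≤M b K′ ⟩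
              pos ℓ b + K′ * M     ≤⟨ +-monoˡ-≤ (K′ * M) s≤q+M ⟩
              q + M + K′ * M       ≡⟨ +-assoc q M (K′ * M) ⟩
              q + (M + K′ * M)     ∎

syndetic-extend : ∀ {y ℓ} → IsUPFactorization y ℓ → ∀ m →
  SyndeticPrefix (derived ℓ) (suc m) → SyndeticPrefix y (suc (suc m))
syndetic-extend {ℓ = ℓ} (pf , unb) m δ-syndetic with 2 ≤? ℓ 0
... | yes 2≤ℓ₀ = syndetic-shorten (pos[1+k]≥2+k 2≤ℓ₀ m) (syndetic-lift δ-syndetic)
  where open Factorization pf ; open BoundedBlocks (λ i → unbordered-≤-head (unb i))
... | no 2≰ℓ₀ = syndetic-constant (unit-blocks-constant unit) (suc (suc m))
  where
    open Factorization pf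
    unit : ∀ i → ℓ i ≡ 1
    unit i = ≤-antisym (≤-trans (unbordered-≤-head (unb i)) (s≤s⁻¹ (≰⇒> 2≰ℓ₀))) (ℓ-positive i)

P⇒syndetic : ∀ m y → P (2 + m) y → SyndeticPrefix y m
P⇒syndetic zero y _ = syndetic-empty y
P⇒syndetic (suc zero) y (_ , ℓ , (pf , unb) , _) = syndetic-letter
  where open Factorization pf ; open BoundedBlocks (λ i → unbordered-≤-head (unb i))
P⇒syndetic (suc (suc m)) y (_ , ℓ , up , _ , δ∈P) =
  syndetic-extend up m (P⇒syndetic (suc m) (derived ℓ) δ∈P)

syndetic⇒factor-recurrent : ∀ {x} p L → SyndeticPrefix x (p + L) →
  ∃ λ K → ∀ q → ∃ λ r → q ≤ r × r + L ≤ q + K × (∀ j → j < L → x (r + j) ≡ x (p + j))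
syndetic⇒factor-recurrent {x} p L (K , recur) = K , λ q → inner q (recur q)
  where
    inner : ∀ q → PrefixOccursWithin x (p + L) q K →
      ∃ λ r → q ≤ r × r + L ≤ q + K × (∀ j → j < L → x (r + j) ≡ x (p + j))
    inner q (r , q≤r , r+p+L≤ , occ) =
      r + p , ≤-trans q≤r (m≤m+n r p) , subst (_≤ q + K) (sym (+-assoc r p L)) r+p+L≤ ,
      λ j j<L → trans (cong x (+-assoc r p j)) (occ (p + j) (+-monoʳ-< p j<L))

mainTheorem8 : (x : Word) → PInfinity x → UniformlyRecurrent x
mainTheorem8 x x∈P∞ p L =
  syndetic⇒factor-recurrent p L (P⇒syndetic (p + L) x (x∈P∞ (suc (p + L))))
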